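{- Let $\mathsf{C}$ be a $*$-autonomous category with dualizing object $0$, let $Q:\mathsf{C}\to\mathsf{SLatt}$ be a monoidal functor, and pick $\omega\in Q(0)$. Then $(0,\omega)$ is a dualizing object of $\int Q^{\jmath}$.
   Context: $(\mathsf{C},\otimes,I,a,\lambda,\rho,\sigma)$ is symmetric monoidal closed with internal hom $\multimap$, counit $\mathrm{ev}_{X,Y}:X\otimes(X\multimap Y)\to Y$; $0$ dualizing means the canonical arrows $j_X:X\to X^{**}$ ($X^*:=X\multimap0$; $j_X$ the transpose of $\mathrm{ev}_{X,0}\circ\sigma_{X^*,X}$) are invertible. A monoidal functor $R:\mathsf{C}\to\mathsf{SLatt}$ (complete lattices, sup-preserving maps) comes with $u_R\in R(I)$ and maps $\mu^R_{X,Y}:R(X)\times R(Y)\to R(X\otimes Y)$, sup-preserving in each variable, natural, with $R(\lambda_Y)(\mu^R_{I,Y}(u_R,y))=y$, $R(\rho_X)(\mu^R_{X,I}(x,u_R))=x$, $R(a)(\mu^R(\mu^R(x,y),z))=\mu^R(x,\mu^R(y,z))$, $R(\sigma_{X,Y})(\mu^R_{X,Y}(x,y))=\mu^R_{Y,X}(y,x)$. Its total category $\int R$ has objects $(X,x)$, $x\in R(X)$, arrows $f:(X,x)\to(Y,y)$ with $R(f)(x)\le y$, tensor $(X,x)\otimes(Y,y)=(X\otimes Y,\mu^R(x,y))$, unit $(I,u_R)$, and is symmetric monoidal closed with $(X,\alpha)\multimap(Y,\beta)=(X\multimap Y,\iota^R_{X,Y}(\alpha,\beta))$ where $\iota^R_{X,Y}(\alpha,-)$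 is right adjoint to $\langle\alpha,-\rangle^R_{X,Y}:=R(\mathrm{ev}_{X,Y})(\mu^R_{X,X\multimap Y}(\alpha,-))$. An object $(0,\omega)$ is dualizing in $\int R$ if every canonical arrow $j_X:(X,\alpha)\to(X^{**},\omega^R_{X^*}(\omega^R_X(\alpha)))$, with $\omega^R_X(\alpha):=\iota^R_{X,0}(\alpha,\omega)$, is invertible in $\int R$. For the given $Q=(Q,u,\mu)$ and $\omega$: $\omega_X(\alpha):=\iota_{X,0}(\alpha,\omega)$, $\beta^\perp:=\bigvee\{\alpha\in Q(X)\mid\langle\alpha,\beta\rangle_{X,0}\le\omega\}$ for $\beta\in Q(X^*)$, $\jmath_X(\alpha):=(\omega_X(\alpha))^\perp$; $Q^\jmath(X):=\{\alpha\in Q(X)\mid\jmath_X(\alpha)=\alpha\}$ (complete lattice with joins $\jmath_X(\bigvee\alpha_i)$), $Q^\jmath(f):=\jmath_Y\circ Q(f)$, with monoidal structure $u^\jmath:=\jmath_I(u)$, $\mu^\jmath_{X,Y}:=\jmath_{X\otimes Y}\circ\mu_{X,Y}$; this makes $Q^\jmath$ a monoidal functor $\mathsf{C}\to\mathsf{SLatt}$, and $\omega\in Q^\jmath(0)$. -}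

module Defs where

open import Level using (Level; _⊔_) renaming (suc to lsuc)
open import Relation.Binary.PropositionalEquality using (_≡_)
open import Data.Product using (Σ; Σ-syntax; _×_; ∃)

record Category (o h : Level) : Set (lsuc (o ⊔ h)) where
  infixr 9 _∘_
  field
    Obj  : Set o
    Hom  : Obj → Obj → Set h
    id   : ∀ {A} → Hom A A
    _∘_  : ∀ {A B C} → Hom B C → Hom A B → Hom A C
    identityˡ : ∀ {A B} {f : Hom A B} → id ∘ f ≡ f
    identityʳ : ∀ {A B} {f : Hom A B} → f ∘ id ≡ f
    assoc     : ∀ {A B C D} {f : Hom A B} {g : Hom B C} {k : Hom C D} →
                (k ∘ g) ∘ f ≡ k ∘ (g ∘ f)

  IsIso : ∀ {A B} → Hom A B → Set h
  IsIso {A} {B} f = Σ[ g ∈ Hom B A ] ((g ∘ f ≡ id) × (f ∘ g ≡ id))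

record SymmetricMonoidalClosed (o h : Level) : Set (lsuc (o ⊔ h)) where
  field
    cat : Category o h
  open Category cat public
  infixr 10 _⊗₀_ _⊗₁_
  infixr 5 _⊸_
  field
    _⊗₀_ : Obj → Obj → Obj
    _⊗₁_ : ∀ {A B C D} → Hom A B → Hom C D → Hom (A ⊗₀ C) (B ⊗₀ D)
    ⊗-id : ∀ {A B} → id {A} ⊗₁ id {B} ≡ id
    ⊗-∘  : ∀ {A B C D E F} {f : Hom B C} {g : Hom A B} {k : Hom E F} {l : Hom D E} →
           (f ∘ g) ⊗₁ (k ∘ l) ≡ (f ⊗₁ k) ∘ (g ⊗₁ l)
    I    : Obj
    a⇒   : ∀ {A B C} → Hom ((A ⊗₀ B) ⊗₀ C) (A ⊗₀ (B ⊗₀ C))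
    a⇐   : ∀ {A B C} → Hom (A ⊗₀ (B ⊗₀ C)) ((A ⊗₀ B) ⊗₀ C)
    a-isoˡ : ∀ {A B C} → a⇐ {A} {B} {C} ∘ a⇒ ≡ id
    a-isoʳ : ∀ {A B C} → a⇒ {A} {B} {C} ∘ a⇐ ≡ id
    a-nat  : ∀ {A B C D E F} {f : Hom A D} {g : Hom B E} {k : Hom C F} →
             a⇒ ∘ ((f ⊗₁ g) ⊗₁ k) ≡ (f ⊗₁ (g ⊗₁ k)) ∘ a⇒
    λ⇒   : ∀ {A} → Hom (I ⊗₀ A) A
    λ⇐   : ∀ {A} → Hom A (I ⊗₀ A)
    λ-isoˡ : ∀ {A} → λ⇐ {A} ∘ λ⇒ ≡ id
    λ-isoʳ : ∀ {A} → λ⇒ {A} ∘ λ⇐ ≡ id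
    λ-nat  : ∀ {A B} {f : Hom A B} → λ⇒ ∘ (id ⊗₁ f) ≡ f ∘ λ⇒
    ρ⇒   : ∀ {A} → Hom (A ⊗₀ I) A
    ρ⇐   : ∀ {A} → Hom A (A ⊗₀ I)
    ρ-isoˡ : ∀ {A} → ρ⇐ {A} ∘ ρ⇒ ≡ id
    ρ-isoʳ : ∀ {A} → ρ⇒ {A} ∘ ρ⇐ ≡ id
    ρ-nat  : ∀ {A B} {f : Hom A B} → ρ⇒ ∘ (f ⊗₁ id) ≡ f ∘ ρ⇒
    σ    : ∀ {A B} → Hom (A ⊗₀ B) (B ⊗₀ A)
    σ-inv : ∀ {A B} → σ {B} {A} ∘ σ {A} {B} ≡ id
    σ-nat : ∀ {A B C D} {f : Hom A C} {g : Hom B D} → σ ∘ (f ⊗₁ g) ≡ (g ⊗₁ f) ∘ σ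
    triangle : ∀ {A B} → (id {A} ⊗₁ λ⇒ {B}) ∘ a⇒ ≡ ρ⇒ ⊗₁ id
    pentagon : ∀ {A B C D} →
               (id {A} ⊗₁ a⇒ {B} {C} {D}) ∘ a⇒ ∘ (a⇒ ⊗₁ id) ≡ a⇒ ∘ a⇒
    hexagon  : ∀ {A B C} →
               a⇒ {B} {C} {A} ∘ σ {A} {B ⊗₀ C} ∘ a⇒ ≡ (id ⊗₁ σ) ∘ a⇒ ∘ (σ ⊗₁ id)
    _⊸_   : Obj → Obj → Obj
    ev    : ∀ {X Y} → Hom (X ⊗₀ (X ⊸ Y)) Y
    curry : ∀ {X Y Z} → Hom (X ⊗₀ Z) Y → Hom Z (X ⊸ Y)
    ev-curry     : ∀ {X Y Z} {f : Hom (X ⊗₀ Z) Y} → ev ∘ (id ⊗₁ curry f) ≡ f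
    curry-unique : ∀ {X Y Z} {f : Hom (X ⊗₀ Z) Y} {g : Hom Z (X ⊸ Y)} →
                   ev ∘ (id ⊗₁ g) ≡ f → g ≡ curry f

  module Dual (𝟘 : Obj) where
    _* : Obj → Obj
    X * = X ⊸ 𝟘

    jc : ∀ X → Hom X ((X *) *)
    jc X = curry (ev {X} {𝟘} ∘ σ {X *} {X})

record StarAutonomous (o h : Level) : Set (lsuc (o ⊔ h)) where
  field
    smc : SymmetricMonoidalClosed o h
  open SymmetricMonoidalClosed smc public
  field
    𝟘 : Obj
  open Dual 𝟘 public
  field
    dualizing : ∀ X → IsIso (jc X)

-- Monoidal functors C → SLatt (complete lattices, sup-preserving maps).
-- Joins are taken of arbitrary subsets, given as predicates.

module _ {o h : Level} (C : SymmetricMonoidalClosed o h) where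
  open SymmetricMonoidalClosed C

  record MonoidalFunctor (c : Level) : Set (o ⊔ h ⊔ lsuc c) where
    field
      El   : Obj → Set c
      _≤_  : ∀ {X} → El X → El X → Set c
      ⋁    : ∀ {X} → (El X → Set c) → El X
      ≤-refl    : ∀ {X} {x : El X} → x ≤ x
      ≤-trans   : ∀ {X} {x y z : El X} → x ≤ y → y ≤ z → x ≤ z
      ≤-antisym : ∀ {X} {x y : El X} → x ≤ y → y ≤ x → x ≡ y
      ⋁-upper   : ∀ {X} (P : El X → Set c) {x} → P x → x ≤ ⋁ P
      ⋁-least   : ∀ {X} (P : El X → Set c) {y} → (∀ x → P x → x ≤ y) → ⋁ P ≤ y
      map    : ∀ {X Y} → Hom X Y → El X → El Y
      map-id : ∀ {X} {x : El X} → map id x ≡ x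
      map-∘  : ∀ {X Y Z} {f : Hom X Y} {g : Hom Y Z} {x} → map (g ∘ f) x ≡ map g (map f x)
      map-⋁  : ∀ {X Y} (f : Hom X Y) (P : El X → Set c) →
               map f (⋁ P) ≡ ⋁ (λ y → ∃ λ x → P x × map f x ≡ y)
      u    : El I
      μ    : ∀ {X Y} → El X → El Y → El (X ⊗₀ Y)
      μ-⋁ˡ : ∀ {X Y} (P : El X → Set c) (y : El Y) →
             μ (⋁ P) y ≡ ⋁ (λ z → ∃ λ x → P x × μ x y ≡ z)
      μ-⋁ʳ : ∀ {X Y} (x : El X) (P : El Y → Set c) →
             μ x (⋁ P) ≡ ⋁ (λ z → ∃ λ y → P y × μ x y ≡ z)
      μ-nat : ∀ {X Y X′ Y′} {f : Hom X X′} {g : Hom Y Y′} {x y} →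
              map (f ⊗₁ g) (μ x y) ≡ μ (map f x) (map g y)
      μ-unitˡ : ∀ {Y} {y : El Y} → map λ⇒ (μ u y) ≡ y
      μ-unitʳ : ∀ {X} {x : El X} → map ρ⇒ (μ x u) ≡ x
      μ-assoc : ∀ {X Y Z} {x : El X} {y : El Y} {z : El Z} →
                map a⇒ (μ (μ x y) z) ≡ μ x (μ y z)
      μ-sym   : ∀ {X Y} {x : El X} {y : El Y} → map σ (μ x y) ≡ μ y x

-- The functor Q^ȷ and the relevant structure of ∫ Q^ȷ, written out on
-- the underlying elements of Q (Q^ȷ(X) = { α ∈ Q(X) | ȷ_X α = α }).

module Nucleus {o h c : Level} (C : StarAutonomous o h)
               (Q : MonoidalFunctor (StarAutonomous.smc C) c)
               (ω : MonoidalFunctor.El Q (StarAutonomous.𝟘 C)) where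
  open StarAutonomous C
  open MonoidalFunctor Q

  pair : ∀ {X Y} → El X → El (X ⊸ Y) → El Y
  pair α γ = map ev (μ α γ)

  ι : ∀ {X Y} → El X → El Y → El (X ⊸ Y)
  ι α β = ⋁ (λ γ → pair α γ ≤ β)

  ωQ : ∀ X → El X → El (X *)
  ωQ X α = ι {X} {𝟘} α ω

  perp : ∀ X → El (X *) → El X
  perp X β = ⋁ (λ α → pair {X} {𝟘} α β ≤ ω)

  ȷ : ∀ X → El X → El X
  ȷ X α = perp X (ωQ X α)

  Inȷ : ∀ X → El X → Set c
  Inȷ X α = ȷ X α ≡ α

  ⋁ȷ : ∀ X → (El X → Set c) → El X
  ⋁ȷ X P = ȷ X (⋁ (λ α → Inȷ X α × P α))

  mapȷ : ∀ {X Y} → Hom X Y → El X → El Y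
  mapȷ {X} {Y} f α = ȷ Y (map f α)

  uȷ : El I
  uȷ = ȷ I u

  μȷ : ∀ {X Y} → El X → El Y → El (X ⊗₀ Y)
  μȷ {X} {Y} α β = ȷ (X ⊗₀ Y) (μ α β)

  pairȷ : ∀ {X Y} → El X → El (X ⊸ Y) → El Y
  pairȷ α γ = mapȷ ev (μȷ α γ)

  ιȷ : ∀ X Y → El X → El Y → El (X ⊸ Y)
  ιȷ X Y α β = ⋁ȷ (X ⊸ Y) (λ γ → pairȷ {X} {Y} α γ ≤ β)

  ωȷ : ∀ X → El X → El (X *)
  ωȷ X α = ιȷ X 𝟘 α ω

  -- arrows of ∫ Q^ȷ :  f : (X,x) → (Y,y)  iff  Q^ȷ(f)(x) ≤ y
  Arrȷ : ∀ {X Y} → Hom X Y → El X → El Y → Set c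
  Arrȷ f x y = mapȷ f x ≤ y

  IsIso∫ȷ : ∀ {X Y} → Hom X Y → El X → El Y → Set (h ⊔ c)
  IsIso∫ȷ {X} {Y} f x y =
    Arrȷ f x y × (Σ[ g ∈ Hom Y X ] (Arrȷ g y x × (g ∘ f ≡ id) × (f ∘ g ≡ id)))

  IsDualizing∫ȷ : Set (o ⊔ h ⊔ c)
  IsDualizing∫ȷ = ∀ X (α : El X) → Inȷ X α →
    IsIso∫ȷ (jc X) α (ωȷ (X *) (ωȷ X α))

{-# OPTIONS --safe #-}
-- ȷ_X = (-)^⊥ ∘ ω_X is the closure operator of the Galois connection between Q(X) and
-- Q(X*) given by pairing into ω, so every ω_X(α) is ȷ-closed and ω itself is ȷ-closed.
-- Hence computing ω^{Q^ȷ}_X inside Q^ȷ changes nothing: ω^{Q^ȷ}_X = ω_X. The dual of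
-- the canonical arrow j_X transposes pairing (⟨β, j_X α⟩ = ⟨α, β⟩), which makes both j_X
-- and its inverse arrows of ∫ Q^ȷ between (X, α) and (X**, ω_{X*}(ω_X α)).
module Submission where

open import Level using (Level) renaming (suc to lsuc)
open import Data.Product using (_,_; _×_; ∃)
open import Relation.Binary.Bundles using (Poset)
open import Relation.Binary.PropositionalEquality
  using (_≡_; refl; sym; trans; cong; isEquivalence; module ≡-Reasoning)
import Relation.Binary.Reasoning.PartialOrder as PartialOrderReasoning
open import Defs

module Dualizing {o h c : Level} (C : StarAutonomous o h)
                 (Q : MonoidalFunctor (StarAutonomous.smc C) c)
                 (ω : MonoidalFunctor.El Q (StarAutonomous.𝟘 C)) where
  open StarAutonomous C
  open MonoidalFunctor Q
  open Nucleus C Q ω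

  ≤-reflexive : ∀ {X} {x y : El X} → x ≡ y → x ≤ y
  ≤-reflexive refl = ≤-refl

  ≤-poset : Obj → Poset c c c
  ≤-poset X = record
    { Carrier        = El X
    ; _≈_            = _≡_
    ; _≤_            = _≤_
    ; isPartialOrder = record
      { isPreorder = record
        { isEquivalence = isEquivalence ; reflexive = ≤-reflexive ; trans = ≤-trans }
      ; antisym    = ≤-antisym
      }
    }

  module ≤-Reasoning {X : Obj} = PartialOrderReasoning (≤-poset X)

  Preserves⋁ : ∀ {X Y} → (El X → El Y) → Set (lsuc c)
  Preserves⋁ F = ∀ P → F (⋁ P) ≡ ⋁ (λ y → ∃ λ x → P x × F x ≡ y)

  ⋁-downset : ∀ {X} (y : El X) → ⋁ (_≤ y) ≡ y
  ⋁-downset y = ≤-antisym (⋁-least _ (λ _ x≤y → x≤y)) (⋁-upper _ ≤-refl)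

  Preserves⋁⇒monotone : ∀ {X Y} {F : El X → El Y} → Preserves⋁ F →
                        ∀ {x y} → x ≤ y → F x ≤ F y
  Preserves⋁⇒monotone {F = F} pres {x} {y} x≤y = begin
    F x                                   ≤⟨ ⋁-upper _ (x , x≤y , refl) ⟩
    ⋁ (λ z → ∃ λ w → w ≤ y × F w ≡ z)     ≡⟨ sym (pres (_≤ y)) ⟩
    F (⋁ (_≤ y))                          ≡⟨ cong F (⋁-downset y) ⟩
    F y                                   ∎
    where open ≤-Reasoning

  Preserves⋁⇒⋁-least : ∀ {X Y} {F : El X → El Y} → Preserves⋁ F →
                       ∀ P {b} → (∀ x → P x → F x ≤ b) → F (⋁ P) ≤ b
  Preserves⋁⇒⋁-least pres P {b} bound rewrite pres P =
    ⋁-least _ λ { _ (x , Px , refl) → bound x Px }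

  map-monotone : ∀ {X Y} (f : Hom X Y) {x y} → x ≤ y → map f x ≤ map f y
  map-monotone f = Preserves⋁⇒monotone (map-⋁ f)

  pair-monoˡ : ∀ {X Y} {γ : El (X ⊸ Y)} {α α′ : El X} → α ≤ α′ → pair α γ ≤ pair α′ γ
  pair-monoˡ {γ = γ} α≤α′ = map-monotone ev (Preserves⋁⇒monotone (λ P → μ-⋁ˡ P γ) α≤α′)

  pair-monoʳ : ∀ {X Y} {α : El X} {γ γ′ : El (X ⊸ Y)} → γ ≤ γ′ → pair α γ ≤ pair α γ′
  pair-monoʳ {α = α} γ≤γ′ = map-monotone ev (Preserves⋁⇒monotone (μ-⋁ʳ α) γ≤γ′)

  pair-⋁-leastˡ : ∀ {X Y} (P : El X → Set c) {γ : El (X ⊸ Y)} {r} →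
                  (∀ α → P α → pair α γ ≤ r) → pair (⋁ P) γ ≤ r
  pair-⋁-leastˡ P {γ} bound rewrite μ-⋁ˡ P γ =
    Preserves⋁⇒⋁-least (map-⋁ ev) _ λ { _ (α , Pα , refl) → bound α Pα }

  pair-⋁-leastʳ : ∀ {X Y} (P : El (X ⊸ Y) → Set c) {α : El X} {r} →
                  (∀ γ → P γ → pair α γ ≤ r) → pair α (⋁ P) ≤ r
  pair-⋁-leastʳ P {α} bound rewrite μ-⋁ʳ α P =
    Preserves⋁⇒⋁-least (map-⋁ ev) _ λ { _ (γ , Pγ , refl) → bound γ Pγ }

  pair-ι≤ : ∀ {X Y} {α : El X} {β : El Y} → pair α (ι α β) ≤ β
  pair-ι≤ = pair-⋁-leastʳ _ (λ _ p → p)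

  pair≤⇒≤ι : ∀ {X Y} {α : El X} {β : El Y} {γ} → pair α γ ≤ β → γ ≤ ι α β
  pair≤⇒≤ι = ⋁-upper _

  pair-perp≤ω : ∀ {X} {β : El (X *)} → pair (perp X β) β ≤ ω
  pair-perp≤ω = pair-⋁-leastˡ _ (λ _ p → p)

  pair≤ω⇒≤perp : ∀ {X} {α : El X} {β} → pair α β ≤ ω → α ≤ perp X β
  pair≤ω⇒≤perp = ⋁-upper _

  ȷ-inflationary : ∀ {X} {α : El X} → α ≤ ȷ X α
  ȷ-inflationary = pair≤ω⇒≤perp pair-ι≤

  ωQ-antitone : ∀ {X} {α α′ : El X} → α ≤ α′ → ωQ X α′ ≤ ωQ X α
  ωQ-antitone α≤α′ = pair≤⇒≤ι (≤-trans (pair-monoˡ α≤α′) pair-ι≤)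

  ȷ-monotone : ∀ {X} {α α′ : El X} → α ≤ α′ → ȷ X α ≤ ȷ X α′
  ȷ-monotone α≤α′ = pair≤ω⇒≤perp (≤-trans (pair-monoʳ (ωQ-antitone α≤α′)) pair-perp≤ω)

  ȷ-least : ∀ {X} {α β : El X} → Inȷ X β → α ≤ β → ȷ X α ≤ β
  ȷ-least {X} {α} {β} β-closed α≤β = begin
    ȷ X α  ≤⟨ ȷ-monotone α≤β ⟩
    ȷ X β  ≡⟨ β-closed ⟩
    β      ∎
    where open ≤-Reasoning

  map-id⊗ : ∀ {X Z Z′} {g : Hom Z Z′} {α : El X} {ζ : El Z} →
            map (id ⊗₁ g) (μ α ζ) ≡ μ α (map g ζ)
  map-id⊗ = trans μ-nat (cong (λ x → μ x _) map-id)

  pair-curry : ∀ {X Y Z} (f : Hom (X ⊗₀ Z) Y) (α : El X) (ζ : El Z) →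
               pair α (map (curry f) ζ) ≡ map f (μ α ζ)
  pair-curry f α ζ = begin
    map ev (μ α (map (curry f) ζ))          ≡⟨ cong (map ev) (sym map-id⊗) ⟩
    map ev (map (id ⊗₁ curry f) (μ α ζ))    ≡⟨ sym map-∘ ⟩
    map (ev ∘ (id ⊗₁ curry f)) (μ α ζ)      ≡⟨ cong (λ k → map k (μ α ζ)) ev-curry ⟩
    map f (μ α ζ)                           ∎
    where open ≡-Reasoning

  pair-jc : ∀ {X} (α : El X) (β : El (X *)) → pair β (map (jc X) α) ≡ pair α β
  pair-jc α β = begin
    pair β (map (jc _) α)     ≡⟨ pair-curry (ev ∘ σ) β α ⟩
    map (ev ∘ σ) (μ β α)      ≡⟨ map-∘ ⟩
    map ev (map σ (μ β α))    ≡⟨ cong (map ev) μ-sym ⟩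
    pair α β                  ∎
    where open ≡-Reasoning

  pair-transpose : ∀ {X Y} (f : Hom X Y) (α : El X) (β : El (Y *)) →
                   pair (map f α) β ≡ pair α (map (curry (ev ∘ (f ⊗₁ id))) β)
  pair-transpose f α β = begin
    map ev (μ (map f α) β)             ≡⟨ cong (λ y → map ev (μ (map f α) y)) (sym map-id) ⟩
    map ev (μ (map f α) (map id β))    ≡⟨ cong (map ev) (sym μ-nat) ⟩
    map ev (map (f ⊗₁ id) (μ α β))     ≡⟨ sym map-∘ ⟩
    map (ev ∘ (f ⊗₁ id)) (μ α β)       ≡⟨ sym (pair-curry _ α β) ⟩
    pair α (map (curry (ev ∘ (f ⊗₁ id))) β) ∎
    where open ≡-Reasoning

  pair-unit : ∀ (γ : El 𝟘) → pair γ (map (curry ρ⇒) u) ≡ γ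
  pair-unit γ = trans (pair-curry ρ⇒ γ u) μ-unitʳ

  ω-Inȷ : Inȷ 𝟘 ω
  ω-Inȷ = ≤-antisym ȷω≤ω ȷ-inflationary
    where
    open ≤-Reasoning
    ȷω≤ω : ȷ 𝟘 ω ≤ ω
    ȷω≤ω = begin
      ȷ 𝟘 ω                                ≡⟨ sym (pair-unit _) ⟩
      pair (ȷ 𝟘 ω) (map (curry ρ⇒) u)      ≤⟨ pair-monoʳ (pair≤⇒≤ι (≤-reflexive (pair-unit ω))) ⟩
      pair (ȷ 𝟘 ω) (ωQ 𝟘 ω)                ≤⟨ pair-perp≤ω ⟩
      ω                                    ∎

  map-ȷ≤ȷ-map : ∀ {X Y} (f : Hom X Y) (α : El X) → map f (ȷ X α) ≤ ȷ Y (map f α)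
  map-ȷ≤ȷ-map f α = pair≤ω⇒≤perp (begin
    pair (map f (ȷ _ α)) β     ≡⟨ pair-transpose f _ β ⟩
    pair (ȷ _ α) (f* β)        ≤⟨ pair-monoʳ f*β≤ωQα ⟩
    pair (ȷ _ α) (ωQ _ α)      ≤⟨ pair-perp≤ω ⟩
    ω                          ∎)
    where
    open ≤-Reasoning
    β = ωQ _ (map f α)
    f* = map (curry (ev ∘ (f ⊗₁ id)))
    f*β≤ωQα : f* β ≤ ωQ _ α
    f*β≤ωQα = pair≤⇒≤ι (≤-trans (≤-reflexive (sym (pair-transpose f α β))) pair-ι≤)

  bidual : ∀ X → El X → El ((X *) *)
  bidual X α = ωQ (X *) (ωQ X α)

  map-jc≤bidual : ∀ {X} (α : El X) → map (jc X) α ≤ bidual X α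
  map-jc≤bidual α = pair≤⇒≤ι (≤-trans (≤-reflexive (pair-jc α _)) pair-ι≤)

  ωQ-Inȷ : ∀ {X} (α : El X) → Inȷ (X *) (ωQ X α)
  ωQ-Inȷ {X} α = ≤-antisym (pair≤⇒≤ι (begin
    pair α (ȷ (X *) (ωQ X α))                     ≡⟨ sym (pair-jc α _) ⟩
    pair (ȷ (X *) (ωQ X α)) (map (jc X) α)        ≤⟨ pair-monoʳ (map-jc≤bidual α) ⟩
    pair (ȷ (X *) (ωQ X α)) (bidual X α)          ≤⟨ pair-perp≤ω ⟩
    ω                                             ∎)) ȷ-inflationary
    where open ≤-Reasoning

  pair≤ω⇒pairȷ≤ω : ∀ {X} {α : El X} {γ} → pair α γ ≤ ω → pairȷ α γ ≤ ω
  pair≤ω⇒pairȷ≤ω {α = α} {γ} p =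
    ȷ-least ω-Inȷ (≤-trans (map-ȷ≤ȷ-map ev (μ α γ)) (ȷ-least ω-Inȷ p))

  pairȷ≤ω⇒pair≤ω : ∀ {X} {α : El X} {γ} → pairȷ α γ ≤ ω → pair α γ ≤ ω
  pairȷ≤ω⇒pair≤ω p = ≤-trans (map-monotone ev ȷ-inflationary) (≤-trans ȷ-inflationary p)

  ωȷ≡ωQ : ∀ X (α : El X) → ωȷ X α ≡ ωQ X α
  ωȷ≡ωQ X α = ≤-antisym
    (ȷ-least (ωQ-Inȷ α) (⋁-least _ λ { _ (_ , p) → pair≤⇒≤ι (pairȷ≤ω⇒pair≤ω p) }))
    (≤-trans (⋁-upper _ (ωQ-Inȷ α , pair≤ω⇒pairȷ≤ω pair-ι≤)) ȷ-inflationary)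

  map-inverse-bidual≤ȷ : ∀ {X} (g : Hom ((X *) *) X) → jc X ∘ g ≡ id →
                         (α : El X) → map g (bidual X α) ≤ ȷ X α
  map-inverse-bidual≤ȷ {X} g jc∘g α = pair≤ω⇒≤perp (begin
    pair (map g (bidual X α)) (ωQ X α)                   ≡⟨ sym (pair-jc _ _) ⟩
    pair (ωQ X α) (map (jc X) (map g (bidual X α)))      ≡⟨ cong (pair (ωQ X α)) jc-g ⟩
    pair (ωQ X α) (bidual X α)                           ≤⟨ pair-ι≤ ⟩
    ω                                                    ∎)
    where
    open ≤-Reasoning
    jc-g : map (jc X) (map g (bidual X α)) ≡ bidual X α
    jc-g = trans (sym map-∘) (trans (cong (λ k → map k (bidual X α)) jc∘g) map-id)

mainTheorem15 : {o h c : Level} (C : StarAutonomous o h)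
                (Q : MonoidalFunctor (StarAutonomous.smc C) c)
                (ω : MonoidalFunctor.El Q (StarAutonomous.𝟘 C)) →
                Nucleus.IsDualizing∫ȷ C Q ω
mainTheorem15 C Q ω X α α-closed with StarAutonomous.dualizing C X
... | g , g∘jc , jc∘g = jc-arrow , g , g-arrow , g∘jc , jc∘g
  where
  open StarAutonomous C
  open MonoidalFunctor Q
  open Nucleus C Q ω
  open Dualizing C Q ω

  bidual≡ : ωȷ (X *) (ωȷ X α) ≡ bidual X α
  bidual≡ = trans (cong (ωȷ (X *)) (ωȷ≡ωQ X α)) (ωȷ≡ωQ (X *) (ωQ X α))

  jc-arrow : Arrȷ (jc X) α (ωȷ (X *) (ωȷ X α))
  jc-arrow rewrite bidual≡ = ȷ-least (ωQ-Inȷ (ωQ X α)) (map-jc≤bidual α)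

  g-arrow : Arrȷ g (ωȷ (X *) (ωȷ X α)) α
  g-arrow rewrite bidual≡ =
    ȷ-least α-closed (≤-trans (map-inverse-bidual≤ȷ g jc∘g α) (≤-reflexive α-closed))
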